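{- Let $D_n=\sum_{k\ge0}\binom{n}{k}\binom{n+k}{k}$ be the central Delannoy numbers and $A_n=\sum_{k\ge0}\binom{n}{k}^2\binom{n+k}{k}$ the Apéry numbers. For $n\in\mathbb{N}$, $$D_n\equiv A_n\equiv\begin{cases}1\pmod 3&\text{if } n\in T(02),\\ 0\pmod 3&\text{otherwise.}\end{cases}$$
   Context: $T(02)$ denotes the set of $n\in\mathbb{N}$ whose base-$3$ expansion contains only the digits $0$ and $2$. -}

module Defs where

open import Data.Nat using (ℕ; zero; suc; _+_; _*_)
open import Data.Nat.Combinatorics using (_C_)
open import Data.List using (List; map; upTo)
open import Data.Nat.ListAction using (sum)

-- Σ_{k=0}^{n} f k   (terms with k > n vanish since n C k = 0)
sumTo : ℕ → (ℕ → ℕ) → ℕ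
sumTo n f = sum (map f (upTo (suc n)))

delannoy : ℕ → ℕ
delannoy n = sumTo n (λ k → (n C k) * ((n + k) C k))

apery : ℕ → ℕ
apery n = sumTo n (λ k → (n C k) * (n C k) * ((n + k) C k))

-- T(02): n whose base-3 expansion uses only digits 0 and 2.
-- Inductively: 0 ∈ T(02); if m ∈ T(02) then 3m and 3m+2 ∈ T(02).
data T02 : ℕ → Set where
  t-zero : T02 0
  t-0    : ∀ {m} → T02 m → T02 (3 * m)
  t-2    : ∀ {m} → T02 m → T02 (3 * m + 2)

-- Write n = r + 3m and k = s + 3j with digits r, s < 3. Lucas' theorem for p = 3 gives
-- C(n, k) ≡ C(m, j) C(r, s) (mod 3), and likewise C(n + k, k) ≡ C(m + j, j) C(r + s, s): when
-- r + s ≥ 3 both sides vanish, the left by Lucas' theorem after the carry and the right since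
-- C(r + s, s) ∈ {3, 6}. So the summands of D_n and A_n factor over the last base-3 digits of n
-- and k, and then so do the sums: F(r + 3m) ≡ F(m) F(r) for F = D, A. As F(0), F(1), F(2) are
-- ≡ 1, 0, 1, F(n) ≡ 0 as soon as n has a digit 1 and F(n) ≡ 1 otherwise.
module Submission where

open import Defs
open import Data.Nat using (ℕ; zero; suc; _+_; _*_; _≤_; _<_; z≤n; s≤s; NonZero)
open import Data.Nat.Properties
open import Data.Nat.Combinatorics using (_C_; nCk+nC[k+1]≡[n+1]C[k+1]; k>n⇒nCk≡0)
open import Data.Nat.DivMod using (_%_; %-distribˡ-+; %-distribˡ-*; m*n%n≡0; _divMod_; result)
open import Data.Nat.Induction using (<-rec)
open import Data.Nat.ListAction using (sum)
open import Data.Fin as Fin using (Fin; toℕ)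
open import Data.Fin.Patterns using (0F; 1F; 2F)
open import Data.Fin.Properties using (toℕ<n)
open import Data.List using (map; applyUpTo)
open import Data.Product using (_×_; _,_)
open import Function using (_∘_)
open import Level using (0ℓ)
open import Relation.Nullary using (¬_)
open import Data.Empty using (⊥-elim)
open import Relation.Binary.Bundles using (Setoid)
open import Relation.Binary.PropositionalEquality
import Relation.Binary.Reasoning.Setoid as SetoidReasoning
import Algebra.Properties.CommutativeSemigroup as CommSemigroupProperties

module Modular (d : ℕ) .{{_ : NonZero d}} where

  infix 4 _≋_
  record _≋_ (m n : ℕ) : Set where
    constructor mod
    field
      %-≡ : m % d ≡ n % d

  open _≋_ public

  ≡⇒≋ : ∀ {m n} → m ≡ n → m ≋ n
  ≡⇒≋ m≡n = mod (cong (_% d) m≡n)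

  ≋-refl : ∀ {m} → m ≋ m
  ≋-refl = mod refl

  ≋-sym : ∀ {m n} → m ≋ n → n ≋ m
  ≋-sym (mod p) = mod (sym p)

  ≋-trans : ∀ {m n o} → m ≋ n → n ≋ o → m ≋ o
  ≋-trans (mod p) (mod q) = mod (trans p q)

  ≋-setoid : Setoid 0ℓ 0ℓ
  ≋-setoid = record
    { Carrier       = ℕ
    ; _≈_           = _≋_
    ; isEquivalence = record { refl = ≋-refl ; sym = ≋-sym ; trans = ≋-trans }
    }

  +-cong-≋ : ∀ {a b c e} → a ≋ b → c ≋ e → a + c ≋ b + e
  +-cong-≋ {a} {b} {c} {e} (mod p) (mod q) = mod (begin
    (a + c) % d            ≡⟨ %-distribˡ-+ a c d ⟩
    (a % d + c % d) % d    ≡⟨ cong₂ (λ x y → (x + y) % d) p q ⟩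
    (b % d + e % d) % d    ≡⟨ %-distribˡ-+ b e d ⟨
    (b + e) % d            ∎)
    where open ≡-Reasoning

  *-cong-≋ : ∀ {a b c e} → a ≋ b → c ≋ e → a * c ≋ b * e
  *-cong-≋ {a} {b} {c} {e} (mod p) (mod q) = mod (begin
    (a * c) % d            ≡⟨ %-distribˡ-* a c d ⟩
    (a % d * (c % d)) % d  ≡⟨ cong₂ (λ x y → (x * y) % d) p q ⟩
    (b % d * (e % d)) % d  ≡⟨ %-distribˡ-* b e d ⟨
    (b * e) % d            ∎)
    where open ≡-Reasoning

  multiple≋0 : ∀ x c → x * (c * d) ≋ 0
  multiple≋0 x c = mod (begin
    x * (c * d) % d  ≡⟨ cong (_% d) (*-assoc x c d) ⟨
    x * c * d % d    ≡⟨ m*n%n≡0 (x * c) d ⟩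
    0                ≡⟨ m*n%n≡0 0 d ⟨
    0 % d            ∎)
    where open ≡-Reasoning

open Modular 3

pascal-≋ : ∀ n k {a b} → n C k ≋ a → n C suc k ≋ b → suc n C suc k ≋ a + b
pascal-≋ n k p q = ≋-trans (≡⇒≋ (sym (nCk+nC[k+1]≡[n+1]C[k+1] n k))) (+-cong-≋ p q)

zero≋multiple : ∀ y z c → y * 0 ≋ z * (c * 3)
zero≋multiple y z c = ≋-trans (≡⇒≋ (*-zeroʳ y)) (≋-sym (multiple≋0 z c))

carry-≋ : ∀ x a b y → a + b ≡ 3 → x * a + x * b ≋ y * 0
carry-≋ x a b y a+b≡3 = ≋-trans (≡⇒≋ (trans (sym (*-distribˡ-+ x a b)) (cong (x *_) a+b≡3)))
                                (≋-sym (zero≋multiple y x 1))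

-- Numbers are written r + m * 3 (not 3 * m + r) so that suc (r + m * 3) and suc m * 3 reduce
-- to digit form, as Pascal's rule needs. There is one lemma per last digit of n because the
-- recursion 2F → 1F → 0F on Fin literals is not structural.
mutual
  lucas₀ : ∀ m j (s : Fin 3) → (m * 3) C (toℕ s + j * 3) ≋ (m C j) * (0 C toℕ s)
  lucas₀ zero    zero    0F = ≋-refl
  lucas₀ zero    (suc j) 0F = ≋-refl
  lucas₀ (suc m) zero    0F = ≋-refl
  lucas₀ (suc m) (suc j) 0F =
    ≋-trans (pascal-≋ (2 + m * 3) (2 + j * 3) (lucas₂ m j 2F) (lucas₂ m (suc j) 0F)) (≡⇒≋ (begin
      (m C j) * 1 + (m C suc j) * 1  ≡⟨ *-distribʳ-+ 1 (m C j) (m C suc j) ⟨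
      (m C j + m C suc j) * 1        ≡⟨ cong (_* 1) (nCk+nC[k+1]≡[n+1]C[k+1] m j) ⟩
      (suc m C suc j) * 1            ∎))
    where open ≡-Reasoning
  lucas₀ zero    j 1F = ≡⇒≋ (sym (*-zeroʳ (0 C j)))
  lucas₀ zero    j 2F = ≡⇒≋ (sym (*-zeroʳ (0 C j)))
  lucas₀ (suc m) j 1F = ≋-trans (pascal-≋ (2 + m * 3) (j * 3) (lucas₂ m j 0F) (lucas₂ m j 1F))
                                (carry-≋ (m C j) 1 2 (suc m C j) refl)
  lucas₀ (suc m) j 2F = ≋-trans (pascal-≋ (2 + m * 3) (1 + j * 3) (lucas₂ m j 1F) (lucas₂ m j 2F))
                                (carry-≋ (m C j) 2 1 (suc m C j) refl)

  lucas₁ : ∀ m j (s : Fin 3) → (1 + m * 3) C (toℕ s + j * 3) ≋ (m C j) * (1 C toℕ s)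
  lucas₁ m zero    0F = ≋-refl
  lucas₁ m (suc j) 0F = ≋-trans (pascal-≋ (m * 3) (2 + j * 3) (lucas₀ m j 2F) (lucas₀ m (suc j) 0F))
                                (≡⇒≋ (cong (_+ (m C suc j) * 1) (*-zeroʳ (m C j))))
  lucas₁ m j 1F = ≋-trans (pascal-≋ (m * 3) (j * 3) (lucas₀ m j 0F) (lucas₀ m j 1F))
                          (≡⇒≋ (sym (*-distribˡ-+ (m C j) 1 0)))
  lucas₁ m j 2F = ≋-trans (pascal-≋ (m * 3) (1 + j * 3) (lucas₀ m j 1F) (lucas₀ m j 2F))
                          (≡⇒≋ (sym (*-distribˡ-+ (m C j) 0 0)))

  lucas₂ : ∀ m j (s : Fin 3) → (2 + m * 3) C (toℕ s + j * 3) ≋ (m C j) * (2 C toℕ s)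
  lucas₂ m zero    0F = ≋-refl
  lucas₂ m (suc j) 0F = ≋-trans (pascal-≋ (1 + m * 3) (2 + j * 3) (lucas₁ m j 2F) (lucas₁ m (suc j) 0F))
                                (≡⇒≋ (cong (_+ (m C suc j) * 1) (*-zeroʳ (m C j))))
  lucas₂ m j 1F = ≋-trans (pascal-≋ (1 + m * 3) (j * 3) (lucas₁ m j 0F) (lucas₁ m j 1F))
                          (≡⇒≋ (sym (*-distribˡ-+ (m C j) 1 1)))
  lucas₂ m j 2F = ≋-trans (pascal-≋ (1 + m * 3) (1 + j * 3) (lucas₁ m j 1F) (lucas₁ m j 2F))
                          (≡⇒≋ (sym (*-distribˡ-+ (m C j) 1 0)))

lucas : ∀ m j (r s : Fin 3) →
        (toℕ r + m * 3) C (toℕ s + j * 3) ≋ (m C j) * (toℕ r C toℕ s)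
lucas m j 0F = lucas₀ m j
lucas m j 1F = lucas₁ m j
lucas m j 2F = lucas₂ m j

lucas-+ : ∀ m j (r s : Fin 3) →
          ((toℕ r + toℕ s) + m * 3) C (toℕ s + j * 3) ≋ (m C j) * ((toℕ r + toℕ s) C toℕ s)
lucas-+ m j 0F s  = lucas m j s s
lucas-+ m j 1F 0F = lucas m j 1F 0F
lucas-+ m j 1F 1F = lucas m j 2F 1F
lucas-+ m j 1F 2F = ≋-trans (lucas (suc m) j 0F 2F) (zero≋multiple (suc m C j) (m C j) 1)
lucas-+ m j 2F 0F = lucas m j 2F 0F
lucas-+ m j 2F 1F = ≋-trans (lucas (suc m) j 0F 1F) (zero≋multiple (suc m C j) (m C j) 1)
lucas-+ m j 2F 2F = ≋-trans (lucas (suc m) j 1F 2F) (zero≋multiple (suc m C j) (m C j) 2)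

digits-+ : ∀ r s m j → (r + m * 3) + (s + j * 3) ≡ (r + s) + (m + j) * 3
digits-+ r s m j = begin
  (r + m * 3) + (s + j * 3)  ≡⟨ +-interchange r (m * 3) s (j * 3) ⟩
  (r + s) + (m * 3 + j * 3)  ≡⟨ cong ((r + s) +_) (*-distribʳ-+ 3 m j) ⟨
  (r + s) + (m + j) * 3      ∎
  where
  open ≡-Reasoning
  open CommSemigroupProperties +-commutativeSemigroup renaming (interchange to +-interchange)

DigitMultiplicative : (ℕ → ℕ) → Set
DigitMultiplicative F = ∀ m (r : Fin 3) → F (toℕ r + m * 3) ≋ F m * F (toℕ r)

DigitMultiplicative₂ : (ℕ → ℕ → ℕ) → Set
DigitMultiplicative₂ t = ∀ m j (r s : Fin 3) →
  t (toℕ r + m * 3) (toℕ s + j * 3) ≋ t m j * t (toℕ r) (toℕ s)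

Triangular : (ℕ → ℕ → ℕ) → Set
Triangular t = ∀ {n k} → n < k → t n k ≡ 0

C[+]-digitMultiplicative₂ : DigitMultiplicative₂ (λ n k → (n + k) C k)
C[+]-digitMultiplicative₂ m j r s =
  subst (λ n → n C (toℕ s + j * 3) ≋ ((m + j) C j) * ((toℕ r + toℕ s) C toℕ s))
        (sym (digits-+ (toℕ r) (toℕ s) m j))
        (lucas-+ (m + j) j r s)

*-digitMultiplicative₂ : ∀ {t u} → DigitMultiplicative₂ t → DigitMultiplicative₂ u →
                         DigitMultiplicative₂ (λ n k → t n k * u n k)
*-digitMultiplicative₂ {t} {u} p q m j r s =
  ≋-trans (*-cong-≋ (p m j r s) (q m j r s))
          (≡⇒≋ (*-interchange (t m j) (t (toℕ r) (toℕ s)) (u m j) (u (toℕ r) (toℕ s))))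
  where open CommSemigroupProperties *-commutativeSemigroup renaming (interchange to *-interchange)

*-triangularˡ : ∀ {t} (u : ℕ → ℕ → ℕ) → Triangular t → Triangular (λ n k → t n k * u n k)
*-triangularˡ u p {n} {k} n<k = cong (_* u n k) (p n<k)

sum< : ℕ → (ℕ → ℕ) → ℕ
sum< zero    f = 0
sum< (suc N) f = f 0 + sum< N (f ∘ suc)

sum-map-applyUpTo : ∀ (f g : ℕ → ℕ) N → sum (map f (applyUpTo g N)) ≡ sum< N (f ∘ g)
sum-map-applyUpTo f g zero    = refl
sum-map-applyUpTo f g (suc N) = cong (f (g 0) +_) (sum-map-applyUpTo f (g ∘ suc) N)

sumTo≡sum< : ∀ n f → sumTo n f ≡ sum< (suc n) f
sumTo≡sum< n f = sum-map-applyUpTo f (λ k → k) (suc n)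

sum<-cong : ∀ N {f g} → (∀ k → f k ≡ g k) → sum< N f ≡ sum< N g
sum<-cong zero    f≡g = refl
sum<-cong (suc N) f≡g = cong₂ _+_ (f≡g 0) (sum<-cong N (f≡g ∘ suc))

sum<-cong-≋ : ∀ N f g → (∀ (k : Fin N) → f (toℕ k) ≋ g (toℕ k)) → sum< N f ≋ sum< N g
sum<-cong-≋ zero    f g f≋g = ≋-refl
sum<-cong-≋ (suc N) f g f≋g = +-cong-≋ (f≋g Fin.zero) (sum<-cong-≋ N (f ∘ suc) (g ∘ suc) (f≋g ∘ Fin.suc))

sum<-zero : ∀ N {f} → (∀ k → f k ≡ 0) → sum< N f ≡ 0
sum<-zero zero    f≡0 = refl
sum<-zero (suc N) f≡0 = cong₂ _+_ (f≡0 0) (sum<-zero N (f≡0 ∘ suc))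

sum<-extend : ∀ {N M} f → N ≤ M → (∀ {k} → N ≤ k → f k ≡ 0) → sum< N f ≡ sum< M f
sum<-extend {M = M} f z≤n       f≡0 = sym (sum<-zero M (λ k → f≡0 z≤n))
sum<-extend         f (s≤s N≤M) f≡0 =
  cong (f 0 +_) (sum<-extend (f ∘ suc) N≤M (λ N≤k → f≡0 (s≤s N≤k)))

sum<-+ : ∀ a b f → sum< (a + b) f ≡ sum< a f + sum< b (λ k → f (a + k))
sum<-+ zero    b f = refl
sum<-+ (suc a) b f = trans (cong (f 0 +_) (sum<-+ a b (f ∘ suc)))
                           (sym (+-assoc (f 0) (sum< a (f ∘ suc)) _))

sum<-*ˡ : ∀ N c f → sum< N (λ k → c * f k) ≡ c * sum< N f
sum<-*ˡ zero    c f = sym (*-zeroʳ c)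
sum<-*ˡ (suc N) c f = trans (cong (c * f 0 +_) (sum<-*ˡ N c (f ∘ suc)))
                            (sym (*-distribˡ-+ c (f 0) _))

sum<-*ʳ : ∀ N f c → sum< N (λ k → f k * c) ≡ sum< N f * c
sum<-*ʳ zero    f c = refl
sum<-*ʳ (suc N) f c = trans (cong (f 0 * c +_) (sum<-*ʳ N (f ∘ suc) c))
                            (sym (*-distribʳ-+ c (f 0) _))

sum<-blocks : ∀ M d f → sum< (M * d) f ≡ sum< M (λ j → sum< d (λ s → f (s + j * d)))
sum<-blocks zero    d f = refl
sum<-blocks (suc M) d f = begin
  sum< (d + M * d) f                                                ≡⟨ sum<-+ d (M * d) f ⟩
  sum< d f + sum< (M * d) (λ k → f (d + k))                         ≡⟨ cong₂ _+_ first rest ⟩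
  sum< d (λ s → f (s + 0)) + sum< M (λ j → sum< d (λ s → f (s + (d + j * d)))) ∎
  where
  open ≡-Reasoning
  open CommSemigroupProperties +-commutativeSemigroup using (x∙yz≈y∙xz)
  first : sum< d f ≡ sum< d (λ s → f (s + 0))
  first = sum<-cong d (λ s → cong f (sym (+-identityʳ s)))
  rest : sum< (M * d) (λ k → f (d + k)) ≡ sum< M (λ j → sum< d (λ s → f (s + (d + j * d))))
  rest = trans (sum<-blocks M d (λ k → f (d + k)))
               (sum<-cong M (λ j → sum<-cong d (λ s → cong f (x∙yz≈y∙xz d s (j * d)))))

diagonalSum-digitMultiplicative : ∀ {t} → DigitMultiplicative₂ t → Triangular t →
                                  DigitMultiplicative (λ n → sumTo n (t n))
diagonalSum-digitMultiplicative {t} mult tri m r = begin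
  sumTo n (t n)                                          ≡⟨ sumTo≡sum< n (t n) ⟩
  sum< (suc n) (t n)                                     ≡⟨ sum<-extend (t n) (+-monoˡ-≤ (m * 3) (toℕ<n r)) tri ⟩
  sum< (suc m * 3) (t n)                                 ≡⟨ sum<-blocks (suc m) 3 (t n) ⟩
  sum< (suc m) block                                     ≈⟨ sum<-cong-≋ (suc m) block block′ (digit-block ∘ toℕ) ⟩
  sum< (suc m) block′                                    ≡⟨ sum<-cong (suc m) (λ j → sum<-*ˡ 3 (t m j) (t r′)) ⟩
  sum< (suc m) (λ j → t m j * sum< 3 (t r′))             ≡⟨ sum<-*ʳ (suc m) (t m) (sum< 3 (t r′)) ⟩
  sum< (suc m) (t m) * sum< 3 (t r′)                     ≡⟨ cong₂ _*_ (sumTo≡sum< m (t m)) digit-sum ⟨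
  sumTo m (t m) * sumTo r′ (t r′)                        ∎
  where
  open SetoidReasoning ≋-setoid
  n r′ : ℕ
  r′ = toℕ r
  n  = r′ + m * 3
  block block′ : ℕ → ℕ
  block  j = sum< 3 (λ s → t n (s + j * 3))
  block′ j = sum< 3 (λ s → t m j * t r′ s)
  digit-block : ∀ j → block j ≋ block′ j
  digit-block j = sum<-cong-≋ 3 (λ s → t n (s + j * 3)) (λ s → t m j * t r′ s) (mult m j r)
  digit-sum : sumTo r′ (t r′) ≡ sum< 3 (t r′)
  digit-sum = trans (sumTo≡sum< r′ (t r′)) (sum<-extend (t r′) (toℕ<n r) tri)

delannoy-digitMultiplicative : DigitMultiplicative delannoy
delannoy-digitMultiplicative =
  diagonalSum-digitMultiplicative
    (*-digitMultiplicative₂ {t = _C_} lucas C[+]-digitMultiplicative₂)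
    (*-triangularˡ (λ n k → (n + k) C k) k>n⇒nCk≡0)

apery-digitMultiplicative : DigitMultiplicative apery
apery-digitMultiplicative =
  diagonalSum-digitMultiplicative
    (*-digitMultiplicative₂ {t = λ n k → (n C k) * (n C k)}
      (*-digitMultiplicative₂ {t = _C_} {u = _C_} lucas lucas)
      C[+]-digitMultiplicative₂)
    (*-triangularˡ (λ n k → (n + k) C k) (*-triangularˡ _C_ k>n⇒nCk≡0))

T02-digit₀ : ∀ {m} → T02 m → T02 (m * 3)
T02-digit₀ {m} t = subst T02 (*-comm 3 m) (t-0 t)

digit₂-form : ∀ m → 2 + m * 3 ≡ 3 * m + 2
digit₂-form m = trans (+-comm 2 (m * 3)) (cong (_+ 2) (*-comm m 3))

T02-digit₂ : ∀ {m} → T02 m → T02 (2 + m * 3)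
T02-digit₂ {m} t = subst T02 (sym (digit₂-form m)) (t-2 t)

module T02Residues (F : ℕ → ℕ) (mult : DigitMultiplicative F)
                   (F0 : F 0 ≋ 1) (F1 : F 1 ≋ 0) (F2 : F 2 ≋ 1) where

  T02⇒≋1 : ∀ {n} → T02 n → F n ≋ 1
  T02⇒≋1 t-zero      = F0
  T02⇒≋1 (t-0 {m} t) =
    subst (λ n → F n ≋ 1) (*-comm m 3) (≋-trans (mult m 0F) (*-cong-≋ (T02⇒≋1 t) F0))
  T02⇒≋1 (t-2 {m} t) =
    subst (λ n → F n ≋ 1) (digit₂-form m) (≋-trans (mult m 2F) (*-cong-≋ (T02⇒≋1 t) F2))

  ¬T02⇒≋0 : ∀ n → ¬ T02 n → F n ≋ 0
  ¬T02⇒≋0 = <-rec (λ n → ¬ T02 n → F n ≋ 0) step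
    where
    step : ∀ n → (∀ {m} → m < n → ¬ T02 m → F m ≋ 0) → ¬ T02 n → F n ≋ 0
    step n ih ¬t with n divMod 3
    ... | result zero    0F refl = ⊥-elim (¬t t-zero)
    ... | result (suc m) 0F refl =
      ≋-trans (mult (suc m) 0F) (*-cong-≋ (ih (m<m*n (suc m) 3 (s≤s (s≤s z≤n))) (¬t ∘ T02-digit₀)) ≋-refl)
    ... | result m       1F refl =
      ≋-trans (mult m 1F) (≋-trans (*-cong-≋ (≋-refl {F m}) F1) (≡⇒≋ (*-zeroʳ (F m))))
    ... | result m       2F refl =
      ≋-trans (mult m 2F) (*-cong-≋ (ih (s≤s (m≤n⇒m≤1+n (m≤m*n m 3))) (¬t ∘ T02-digit₂)) ≋-refl)

theorem5p8 : (n : ℕ) →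
    (T02 n → (delannoy n % 3 ≡ 1 × apery n % 3 ≡ 1)) ×
    (¬ T02 n → (delannoy n % 3 ≡ 0 × apery n % 3 ≡ 0))
theorem5p8 n =
  (λ t  → %-≡ (D.T02⇒≋1 t) , %-≡ (A.T02⇒≋1 t)) ,
  (λ ¬t → %-≡ (D.¬T02⇒≋0 n ¬t) , %-≡ (A.¬T02⇒≋0 n ¬t))
  where
  module D = T02Residues delannoy delannoy-digitMultiplicative (mod refl) (mod refl) (mod refl)
  module A = T02Residues apery apery-digitMultiplicative (mod refl) (mod refl) (mod refl)
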